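{- Let $k\geq 2$ be an integer. For an integer $n\geq 3$, let $\mathscr{B}_{k,n}$ be the set of cyclic binary strings of length $n$ in which every block has length at least $k$ if $n\geq k$, or every block has length exactly $n$ if $n<k$, and let $a_k(n)=|\mathscr{B}_{k,n}|$. Then $a_k(i)=2$ for $3\leq i\leq 2k-1$, $a_k(j)=2+j(j-2k+1)$ for $2k\leq j\leq 2k+2$, and, for $n\geq 2k+3$, $$a_k(n)=2a_k(n-1)-a_k(n-2)+a_k(n-2k).$$
   Context: A cyclic binary string of length $n$ is a word $b_1b_2\cdots b_n\in\{0,1\}^n$ whose positions are read cyclically, so that position $n$ is followed by position $1$; two such words are considered different whenever they differ as words (cyclic shifts of a string are counted as distinct strings). A block is a maximal (in the cyclic sense) run of consecutive equal bits; in particular the constant strings $00\cdots0$ and $11\cdots1$ each consist of a single block of length $n$. -}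

module Defs where

open import Data.Bool using (Bool; true; false)
import Data.Bool.Properties as BoolP
open import Data.Nat using (ℕ; zero; suc; _+_; _∸_; _≤_; _<_; _≤?_)
import Data.Nat.Properties as NatP
open import Data.Nat.DivMod using (_%_; m%n<n)
open import Data.Fin using (Fin; toℕ; fromℕ<)
open import Data.Fin.Properties using (all?)
open import Data.Vec using (Vec; []; _∷_; lookup)
open import Data.List using (List; []; _∷_; _++_; concatMap; length; filter)
open import Data.Product using (_×_)
open import Data.Sum using (_⊎_)
open import Relation.Binary.PropositionalEquality using (_≡_; _≢_)
open import Relation.Nullary using (Dec; ¬?)
open import Relation.Nullary.Decidable using (_×-dec_; _⊎-dec_; _→-dec_)

-- A cyclic binary string of length n is a word in {0,1}^n, modelled as Vec Bool n.
-- Cyclic reading: position j (any natural number) denotes position j mod n.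
at : ∀ {n} → Vec Bool n → ℕ → Bool
at {zero}  _ _ = false
at {suc n} b j = lookup b (fromℕ< (m%n<n j (suc n)))

-- IsBlock b i L : the cyclic run of length L starting at position i is a block,
-- i.e. a maximal (in the cyclic sense) run of consecutive equal bits:
--   * 1 ≤ L ≤ n,
--   * the bits at positions i, i+1, ..., i+L-1 (mod n) all equal the bit at i,
--   * maximality: either the run is the whole cycle (L = n, constant string),
--     or the bit before position i and the bit after the run differ from it.
IsBlock : ∀ {n} → Vec Bool n → ℕ → ℕ → Set
IsBlock {n} b i L =
  (1 ≤ L) × (L ≤ n) ×
  ((j : Fin L) → at b (i + toℕ j) ≡ at b i) ×
  (L ≡ n ⊎ (at b (i + (n ∸ 1)) ≢ at b i × at b (i + L) ≢ at b i))

InB : (k n : ℕ) → Vec Bool n → Set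
InB k n b =
  (k ≤ n → (i : Fin n) (L : Fin (suc n)) → IsBlock b (toℕ i) (toℕ L) → k ≤ toℕ L) ×
  (n < k → (i : Fin n) (L : Fin (suc n)) → IsBlock b (toℕ i) (toℕ L) → toℕ L ≡ n)

isBlock? : ∀ {n} (b : Vec Bool n) (i L : ℕ) → Dec (IsBlock b i L)
isBlock? {n} b i L =
  (1 ≤? L) ×-dec (L ≤? n) ×-dec
  all? (λ j → at b (i + toℕ j) BoolP.≟ at b i) ×-dec
  ((L NatP.≟ n) ⊎-dec
    (¬? (at b (i + (n ∸ 1)) BoolP.≟ at b i) ×-dec ¬? (at b (i + L) BoolP.≟ at b i)))

inB? : (k n : ℕ) (b : Vec Bool n) → Dec (InB k n b)
inB? k n b =
  ((k ≤? n) →-dec all? (λ i → all? (λ L → isBlock? b (toℕ i) (toℕ L) →-dec (k ≤? toℕ L)))) ×-dec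
  ((suc n ≤? k) →-dec all? (λ i → all? (λ L → isBlock? b (toℕ i) (toℕ L) →-dec (toℕ L NatP.≟ n))))

allStrings : (n : ℕ) → List (Vec Bool n)
allStrings zero    = [] ∷ []
allStrings (suc n) = concatMap (λ v → (false ∷ v) ∷ (true ∷ v) ∷ []) (allStrings n)

a : ℕ → ℕ → ℕ
a k n = length (filter (inB? k n) (allStrings n))

module Submission where

open import Defs
open import Data.Nat using (ℕ; _+_; _*_; _∸_; _≤_; _<_)
open import Data.Product using (_×_)
open import Relation.Binary.PropositionalEquality using (_≡_)

open import Data.Bool using (Bool; true; false; not; if_then_else_)
open import Data.Bool.Properties using () renaming (_≟_ to _≟ᵇ_)
open import Data.Empty using (⊥; ⊥-elim)
open import Data.Fin using (Fin; toℕ; fromℕ<)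
open import Data.Fin.Properties using (toℕ-fromℕ<; fromℕ<-cong; toℕ<n)
open import Data.List using (List; []; _∷_; concatMap; length; filter)
open import Data.Nat using (zero; suc; pred; z≤n; s≤s; z<s; _≤?_; _≟_; _%_)
open import Data.Nat.DivMod using (m%n<n; m%n%n≡m%n; [m+n]%n≡m%n; n%n≡0; %-distribˡ-+; m<n⇒m%n≡m)
open import Data.Nat.Properties
open import Algebra.Properties.CommutativeSemigroup +-commutativeSemigroup using (interchange)
open import Data.Nat.Solver using (module +-*-Solver)
open import Data.Product using (_,_; proj₁; proj₂; ∃; ∃₂)
open import Data.Sum using (_⊎_; inj₁; inj₂)
open import Data.Unit using (⊤)
open import Data.Vec using (Vec; []; _∷_; lookup)
open import Function using (_⇔_; mk⇔; Equivalence)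
open import Function.Properties.Equivalence using () renaming (trans to ⇔-trans)
open import Relation.Binary.PropositionalEquality
open import Relation.Nullary using (Dec; does; yes; no; ¬_)
open import Relation.Nullary.Decidable using (dec-true; dec-false)
open import Relation.Unary using (Pred; Decidable)
open +-*-Solver using (solve; _:+_; _:*_; _:=_; con)

-- A cyclic word is in B_{k,n} exactly when every block boundary is
-- followed by k equal bits ('CyclicLong').  We decide this by reading the word once from
-- position 1 with an automaton that remembers the first bit x, the length p of the first
-- block and, once that block has ended, the current bit c and the deficit d: how many more
-- bits the current block still needs to reach length k.  Going once around the cycle and k
-- bits beyond checks every boundary; those k extra bits are the first block again, so the
-- verdict depends only on (x, p, c, d) ('closes').  Splitting on the next bit, the number of
-- accepted words obeys a linear recursion ('ways'), solved in closed form: a_k(n) = 2·half n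
-- with half n = 1 + k·F(n−k) + S(n−k−1), where F counts linear continuations and S is its
-- prefix sum.  The initial values and the recurrence follow from recurrences for F.

b2n : Bool → ℕ
b2n b = if b then 1 else 0

⇔-both : ∀ {A : Set} {b} → b ≡ true → A → (b ≡ true) ⇔ A
⇔-both b≡true holds = mk⇔ (λ _ → holds) (λ _ → b≡true)

⇔-neither : ∀ {A : Set} {b} → b ≡ false → ¬ A → (b ≡ true) ⇔ A
⇔-neither b≡false fails =
  mk⇔ (λ b≡true → ⊥-elim (false≢true (trans (sym b≡false) b≡true))) (λ holds → ⊥-elim (fails holds))
  where
    false≢true : false ≢ true
    false≢true ()

does-by : ∀ {P : Set} (P? : Dec P) {c} → (c ≡ true) ⇔ P → does P? ≡ c
does-by (yes p) {true}  _   = refl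
does-by (yes p) {false} c⇔P = sym (Equivalence.from c⇔P p)
does-by (no ¬p) {true}  c⇔P = ⊥-elim (¬p (Equivalence.to c⇔P refl))
does-by (no ¬p) {false} _   = refl

first-change : ∀ (g : ℕ → Bool) y N →
  (∀ j → j < N → g j ≡ y) ⊎ ∃ λ L → L < N × g L ≢ y × (∀ j → j < L → g j ≡ y)
first-change g y zero = inj₁ (λ j ())
first-change g y (suc N) with first-change g y N
... | inj₂ (L , L<N , changed , before) = inj₂ (L , m<n⇒m<1+n L<N , changed , before)
... | inj₁ before with g N ≟ᵇ y
...   | no  changed = inj₂ (N , n<1+n N , changed , before)
...   | yes same    = inj₁ before′
  where
    before′ : ∀ j → j < suc N → g j ≡ y
    before′ j j<N with m≤n⇒m<n∨m≡n (≤-pred j<N)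
    ... | inj₁ j<N′ = before j j<N′
    ... | inj₂ refl = same

doubled-rec : ∀ h₃ h₁ h₂ h₀ → h₃ + h₁ ≡ 2 * h₂ + h₀ →
              (h₃ + h₃) + (h₁ + h₁) ≡ 2 * (h₂ + h₂) + (h₀ + h₀)
doubled-rec h₃ h₁ h₂ h₀ rec = begin
  (h₃ + h₃) + (h₁ + h₁)      ≡⟨ solve 2 (λ x y → (x :+ x) :+ (y :+ y) := (x :+ y) :+ (x :+ y)) refl h₃ h₁ ⟩
  (h₃ + h₁) + (h₃ + h₁)      ≡⟨ cong₂ _+_ rec rec ⟩
  (2 * h₂ + h₀) + (2 * h₂ + h₀)
    ≡⟨ solve 2 (λ x y → (con 2 :* x :+ y) :+ (con 2 :* x :+ y) := con 2 :* (x :+ x) :+ (y :+ y)) refl h₂ h₀ ⟩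
  2 * (h₂ + h₂) + (h₀ + h₀)  ∎
  where open ≡-Reasoning

count : (n : ℕ) → (Vec Bool n → Bool) → ℕ
count zero    g = b2n (g [])
count (suc n) g = count n (λ v → g (false ∷ v)) + count n (λ v → g (true ∷ v))

count-cong : ∀ n {g h : Vec Bool n → Bool} → (∀ v → g v ≡ h v) → count n g ≡ count n h
count-cong zero    g≗h = cong b2n (g≗h [])
count-cong (suc n) g≗h = cong₂ _+_ (count-cong n (λ v → g≗h (false ∷ v))) (count-cong n (λ v → g≗h (true ∷ v)))

count-false : ∀ n → count n (λ _ → false) ≡ 0
count-false zero    = refl
count-false (suc n) = cong₂ _+_ (count-false n) (count-false n)

tally : ∀ {n} → (Vec Bool n → Bool) → List (Vec Bool n) → ℕ
tally g []       = 0
tally g (v ∷ vs) = b2n (g v) + tally g vs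

length-filter : ∀ {n ℓ} {P : Pred (Vec Bool n) ℓ} (P? : Decidable P) vs →
                length (filter P? vs) ≡ tally (λ v → does (P? v)) vs
length-filter P? []       = refl
length-filter P? (v ∷ vs) with does (P? v)
... | false = length-filter P? vs
... | true  = cong suc (length-filter P? vs)

tally-extend : ∀ {n} (g : Vec Bool (suc n) → Bool) vs →
  tally g (concatMap (λ v → (false ∷ v) ∷ (true ∷ v) ∷ []) vs) ≡
  tally (λ v → g (false ∷ v)) vs + tally (λ v → g (true ∷ v)) vs
tally-extend g []       = refl
tally-extend g (v ∷ vs) = trans (sym (+-assoc (b2n (g (false ∷ v))) (b2n (g (true ∷ v))) _))
  (trans (cong (b2n (g (false ∷ v)) + b2n (g (true ∷ v)) +_) (tally-extend g vs))
         (interchange (b2n (g (false ∷ v))) (b2n (g (true ∷ v)))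
                      (tally (λ u → g (false ∷ u)) vs) (tally (λ u → g (true ∷ u)) vs)))

tally-allStrings : ∀ n (g : Vec Bool n → Bool) → tally g (allStrings n) ≡ count n g
tally-allStrings zero    g = +-identityʳ (b2n (g []))
tally-allStrings (suc n) g = trans (tally-extend g (allStrings n)) (cong₂ _+_ (tally-allStrings n _) (tally-allStrings n _))

count-allStrings : ∀ n {ℓ} {P : Pred (Vec Bool n) ℓ} (P? : Decidable P) →
                   length (filter P? (allStrings n)) ≡ count n (λ v → does (P? v))
count-allStrings n P? = trans (length-filter P? (allStrings n)) (tally-allStrings n _)

-- Fix k = K1 + 1.  While reading a word after its first block, the
-- relevant state is (e , d): e says whether the current bit equals the first bit of the
-- word, d is the deficit of the current block.  From deficit 0 the next bit may stay (same
-- state) or switch (colour flips, deficit K1); from deficit d+1 it must stay (deficit d).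
-- 'ways w e d m' adds up the weight w of the final states of all m-bit continuations from
-- (e , d).
module Paths (K1 : ℕ) where

  k : ℕ
  k = suc K1

  Weight : Set
  Weight = Bool → ℕ → ℕ

  ways : Weight → Bool → ℕ → ℕ → ℕ
  ways w e d       zero    = w e d
  ways w e zero    (suc m) = ways w e zero m + ways w (not e) K1 m
  ways w e (suc d) (suc m) = ways w e d m

  -- Reachable states have deficit at most K1, so weights only matter there.
  ways-cong : ∀ {w w′} → (∀ e d → d ≤ K1 → w e d ≡ w′ e d) →
              ∀ e d m → d ≤ K1 → ways w e d m ≡ ways w′ e d m
  ways-cong w≗w′ e d       zero    d≤K1 = w≗w′ e d d≤K1
  ways-cong w≗w′ e zero    (suc m) _    =
    cong₂ _+_ (ways-cong w≗w′ e 0 m z≤n) (ways-cong w≗w′ (not e) K1 m ≤-refl)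
  ways-cong w≗w′ e (suc d) (suc m) d<K1 = ways-cong w≗w′ e d m (<⇒≤ d<K1)

  ways-compose : ∀ w e d m c → ways w e d (m + c) ≡ ways (λ e′ d′ → ways w e′ d′ c) e d m
  ways-compose w e d       zero    c = refl
  ways-compose w e zero    (suc m) c =
    cong₂ _+_ (ways-compose w e 0 m c) (ways-compose w (not e) K1 m c)
  ways-compose w e (suc d) (suc m) c = ways-compose w e d m c

  ways-flip : ∀ w e d m → ways w (not e) d m ≡ ways (λ e′ → w (not e′)) e d m
  ways-flip w e d       zero    = refl
  ways-flip w e zero    (suc m) = cong₂ _+_ (ways-flip w e 0 m) (ways-flip w (not e) K1 m)
  ways-flip w e (suc d) (suc m) = ways-flip w e d m

  ways-+ : ∀ w w′ e d m → ways (λ e′ d′ → w e′ d′ + w′ e′ d′) e d m ≡ ways w e d m + ways w′ e d m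
  ways-+ w w′ e d       zero    = refl
  ways-+ w w′ e zero    (suc m) =
    trans (cong₂ _+_ (ways-+ w w′ e 0 m) (ways-+ w w′ (not e) K1 m))
          (interchange (ways w e 0 m) (ways w′ e 0 m) (ways w (not e) K1 m) (ways w′ (not e) K1 m))
  ways-+ w w′ e (suc d) (suc m) = ways-+ w w′ e d m

  ways-forced : ∀ w e d m → ways w e d (d + m) ≡ ways w e 0 m
  ways-forced w e zero    m = refl
  ways-forced w e (suc d) m = ways-forced w e d m

  -- The weight of the state 'back in the first colour with no deficit'.
  hit : Weight
  hit e     (suc d) = 0
  hit false zero    = 0
  hit true  zero    = 1

  ways-hit-late : ∀ e d m → m < d → ways hit e d m ≡ 0
  ways-hit-late e (suc d) zero    _         = refl
  ways-hit-late e (suc d) (suc m) (s≤s m<d) = ways-hit-late e d m m<d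

  -- Within K1 bits no two switches fit, so from deficit 0 the only way to end in
  -- (first colour, no deficit) is to keep the colour.
  ways-hit-short : ∀ e c → c ≤ K1 → ways hit e 0 c ≡ hit e 0
  ways-hit-short e zero    _    = refl
  ways-hit-short e (suc c) c<K1 = begin
    ways hit e 0 c + ways hit (not e) K1 c
      ≡⟨ cong₂ _+_ (ways-hit-short e c (<⇒≤ c<K1)) (ways-hit-late (not e) K1 c c<K1) ⟩
    hit e 0 + 0
      ≡⟨ +-identityʳ (hit e 0) ⟩
    hit e 0 ∎
    where open ≡-Reasoning

  ways-hit-within : ∀ e d c → d ≤ c → c ≤ K1 → ways hit e d c ≡ hit e 0
  ways-hit-within e zero    c       _         c≤K1 = ways-hit-short e c c≤K1
  ways-hit-within e (suc d) (suc c) (s≤s d≤c) c<K1 = ways-hit-within e d c d≤c (<⇒≤ c<K1)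

  -- Acceptance at the end of the word, when the first block (colour x) has length p
  -- and the run ended in state (e , d): if e the last block continues into the first
  -- block, which must pay off d; otherwise the first block starts a new block, so the
  -- last one must be finished and the first one must be long.
  closes : ℕ → Bool → ℕ → Bool
  closes p true  d       = does (d ≤? p)
  closes p false zero    = does (k ≤? p)
  closes p false (suc d) = false

  accepts : ℕ → Weight
  accepts p e d = b2n (closes p e d)

  -- F j (resp. T j): continuations of length j leading from a finished block of the
  -- other (resp. the first) colour to a finished block of the first colour.
  F T : ℕ → ℕ
  F j = ways hit false 0 j
  T j = ways hit true 0 j

  S : ℕ → ℕ
  S zero    = F 0
  S (suc j) = S j + F (suc j)

  S-step : ∀ x → S (pred x) + F x ≡ S x
  S-step zero    = refl
  S-step (suc x) = refl

  F-short : ∀ j → j ≤ K1 → F j ≡ 0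
  F-short j j≤K1 = ways-hit-short false j j≤K1

  S-short : ∀ j → j ≤ K1 → S j ≡ 0
  S-short zero    _    = refl
  S-short (suc j) j<K1 = cong₂ _+_ (S-short j (<⇒≤ j<K1)) (F-short (suc j) j<K1)

  -- Right after a switch the deficit K1 is forced first.
  switch-F : ∀ x → ways hit false K1 x ≡ F (x ∸ K1)
  switch-F x with K1 ≤? x
  ... | yes K1≤x = trans (cong (ways hit false K1) (sym (m+[n∸m]≡n K1≤x))) (ways-forced hit false K1 (x ∸ K1))
  ... | no  K1≰x = trans (ways-hit-late false K1 x (≰⇒> K1≰x)) (cong F (sym (m≤n⇒m∸n≡0 (<⇒≤ (≰⇒> K1≰x)))))

  -- One more bit from the first colour: stay, or switch and come back later.
  T-suc : ∀ s → T (suc s) ≡ T s + F (s ∸ K1)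
  T-suc s = cong (T s +_) (switch-F s)

  T-closed : ∀ s → T s ≡ 1 + S (s ∸ k)
  T-closed zero    = refl
  T-closed (suc s) = begin
    T (suc s)                             ≡⟨ T-suc s ⟩
    T s + F (s ∸ K1)                      ≡⟨ cong (_+ F (s ∸ K1)) (T-closed s) ⟩
    1 + (S (s ∸ k) + F (s ∸ K1))          ≡⟨ cong (λ z → 1 + (S z + F (s ∸ K1))) (sym (pred[m∸n]≡m∸[1+n] s K1)) ⟩
    1 + (S (pred (s ∸ K1)) + F (s ∸ K1))  ≡⟨ cong suc (S-step (s ∸ K1)) ⟩
    1 + S (s ∸ K1)                        ∎
    where open ≡-Reasoning

  T-early : ∀ s → s ≤ k → T s ≡ 1
  T-early s s≤k = trans (T-closed s) (cong (λ z → 1 + S z) (m≤n⇒m∸n≡0 s≤k))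

  shift-index : ∀ x → x + k ≡ K1 + suc x
  shift-index x = trans (+-suc x K1) (trans (cong suc (+-comm x K1)) (sym (+-suc K1 x)))

  -- F grows by T: the last switch back to the first colour happened K1 + 1 bits
  -- before the end, or not at all.
  F-after : ∀ x → F (suc (x + k)) ≡ F (x + k) + T (suc x)
  F-after x = cong (F (x + k) +_)
    (trans (cong (ways hit true K1) (shift-index x)) (ways-forced hit true K1 (suc x)))

  accepts-short : ∀ p → p ≤ K1 → ∀ e d → d ≤ K1 → accepts p e d ≡ ways hit e d p
  accepts-short p p≤K1 true d _ with d ≤? p
  ... | yes d≤p = trans (cong b2n (dec-true (d ≤? p) d≤p)) (sym (ways-hit-within true d p d≤p p≤K1))
  ... | no  d≰p = trans (cong b2n (dec-false (d ≤? p) d≰p)) (sym (ways-hit-late true d p (≰⇒> d≰p)))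
  accepts-short p p≤K1 false zero _ =
    trans (cong b2n (dec-false (k ≤? p) (<⇒≱ (s≤s p≤K1)))) (sym (ways-hit-short false p p≤K1))
  accepts-short p p≤K1 false (suc d) _ with suc d ≤? p
  ... | yes d<p = sym (ways-hit-within false (suc d) p d<p p≤K1)
  ... | no  d≮p = sym (ways-hit-late false (suc d) p (≰⇒> d≮p))

  hit-false : ∀ d → hit false d ≡ 0
  hit-false zero    = refl
  hit-false (suc d) = refl

  accepts-long : ∀ p → k ≤ p → ∀ e d → d ≤ K1 → accepts p e d ≡ ways hit e d K1 + hit (not e) d
  accepts-long p k≤p true d d≤K1 =
    trans (cong b2n (dec-true (d ≤? p) (≤-trans d≤K1 (<⇒≤ k≤p))))
          (sym (cong₂ _+_ (ways-hit-within true d K1 d≤K1 ≤-refl) (hit-false d)))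
  accepts-long p k≤p false zero _ =
    trans (cong b2n (dec-true (k ≤? p) k≤p)) (sym (cong (_+ 1) (ways-hit-short false K1 ≤-refl)))
  accepts-long p k≤p false (suc d) d<K1 =
    sym (cong (_+ 0) (ways-hit-within false (suc d) K1 d<K1 ≤-refl))

  -- Accepted completions of m bits right after the first block of length p ended.
  afterFirst : ℕ → ℕ → ℕ
  afterFirst p m = ways (accepts p) false K1 m

  -- Short first block: the first block is read again at the end.
  afterFirst-short : ∀ p → p ≤ K1 → ∀ m → afterFirst p m ≡ F ((m + p) ∸ K1)
  afterFirst-short p p≤K1 m = begin
    ways (accepts p) false K1 m                  ≡⟨ ways-cong (accepts-short p p≤K1) false K1 m ≤-refl ⟩
    ways (λ e d → ways hit e d p) false K1 m     ≡⟨ ways-compose hit false K1 m p ⟨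
    ways hit false K1 (m + p)                    ≡⟨ switch-F (m + p) ⟩
    F ((m + p) ∸ K1)                             ∎
    where open ≡-Reasoning

  afterFirst-long : ∀ p → k ≤ p → ∀ m → afterFirst p m ≡ F (suc m)
  afterFirst-long p k≤p m = begin
    ways (accepts p) false K1 m
      ≡⟨ ways-cong (accepts-long p k≤p) false K1 m ≤-refl ⟩
    ways (λ e d → ways hit e d K1 + hit (not e) d) false K1 m
      ≡⟨ ways-+ (λ e d → ways hit e d K1) (λ e d → hit (not e) d) false K1 m ⟩
    ways (λ e d → ways hit e d K1) false K1 m + ways (λ e d → hit (not e) d) false K1 m
      ≡⟨ cong₂ _+_ (ways-compose hit false K1 m K1) (ways-flip hit false K1 m) ⟨
    ways hit false K1 (m + K1) + ways hit true K1 m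
      ≡⟨ cong (_+ ways hit true K1 m) (trans (switch-F (m + K1)) (cong F (m+n∸n≡m m K1))) ⟩
    F m + ways hit true K1 m
      ∎
    where open ≡-Reasoning

  -- Accepted completions of m bits while still inside the first block, of length p so
  -- far: either the block goes on or it ends here.
  firstRun : ℕ → ℕ → ℕ
  firstRun p zero    = 1
  firstRun p (suc m) = firstRun (suc p) m + afterFirst p m

  -- Once the first block is long, only the final block matters.
  firstRun-long : ∀ p → k ≤ p → ∀ m → firstRun p m ≡ 1 + S m
  firstRun-long p k≤p zero    = refl
  firstRun-long p k≤p (suc m) =
    cong₂ _+_ (firstRun-long (suc p) (m≤n⇒m≤1+n k≤p) m) (afterFirst-long p k≤p m)

  firstRun-short : ∀ p → p ≤ k → ∀ m →
    firstRun p m ≡ 1 + (suc k ∸ p) * F ((m + p) ∸ k) + S (pred ((m + p) ∸ k))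
  firstRun-short p p≤k zero rewrite m≤n⇒m∸n≡0 p≤k =
    sym (cong (λ z → 1 + z + 0) (*-zeroʳ (suc k ∸ p)))
  firstRun-short p p≤k (suc m) with p ≟ k
  ... | yes refl = begin
    firstRun k (suc m)                        ≡⟨ firstRun-long k ≤-refl (suc m) ⟩
    1 + (S m + F (suc m))                     ≡⟨ cong suc (+-comm (S m) (F (suc m))) ⟩
    1 + (F (suc m) + S m)                     ≡⟨ cong (λ z → 1 + z + S m) (*-identityˡ (F (suc m))) ⟨
    1 + 1 * F (suc m) + S m
      ≡⟨ cong₂ (λ c x → 1 + c * F x + S (pred x)) (m+n∸n≡m 1 k) (m+n∸n≡m (suc m) k) ⟨
    1 + (suc k ∸ k) * F ((suc m + k) ∸ k) + S (pred ((suc m + k) ∸ k)) ∎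
    where open ≡-Reasoning
  ... | no p≢k = begin
    firstRun (suc p) m + afterFirst p m
      ≡⟨ cong₂ _+_ (firstRun-short (suc p) p<k m) (afterFirst-short p (≤-pred p<k) m) ⟩
    1 + (k ∸ p) * F ((m + suc p) ∸ k) + S (pred ((m + suc p) ∸ k)) + F x
      ≡⟨ cong (λ y → 1 + (k ∸ p) * F (y ∸ k) + S (pred (y ∸ k)) + F x) (+-suc m p) ⟩
    1 + (k ∸ p) * F x + S (pred x) + F x
      ≡⟨ solve 3 (λ c f s → con 1 :+ c :* f :+ s :+ f := con 1 :+ (con 1 :+ c) :* f :+ s) refl
               (k ∸ p) (F x) (S (pred x)) ⟩
    1 + suc (k ∸ p) * F x + S (pred x)
      ≡⟨ cong (λ c → 1 + c * F x + S (pred x)) (+-∸-assoc 1 p≤k) ⟨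
    1 + (suc k ∸ p) * F x + S (pred x) ∎
    where
      open ≡-Reasoning
      p<k : p < k
      p<k = ≤∧≢⇒< p≤k p≢k
      x : ℕ
      x = (m + p) ∸ K1

  -- Half of a_k(n), in closed form (words starting with 0 and with 1 are equinumerous).
  half : ℕ → ℕ
  half n = 1 + k * F (n ∸ k) + S (pred (n ∸ k))

  firstRun-half : ∀ n′ → firstRun 1 n′ ≡ half (suc n′)
  firstRun-half n′ = trans (firstRun-short 1 (s≤s z≤n) n′)
    (cong (λ x → 1 + k * F (x ∸ k) + S (pred (x ∸ k))) (+-comm n′ 1))

  half-shift : ∀ y → half (y + k) ≡ 1 + k * F y + S (pred y)
  half-shift y = cong (λ x → 1 + k * F x + S (pred x)) (m+n∸n≡m y k)

  half-2k : ∀ x → half (x + 2 * k) ≡ 1 + k * F (x + k) + S (pred (x + k))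
  half-2k x = trans (cong half (trans (cong (λ z → x + (k + z)) (+-identityʳ k)) (sym (+-assoc x k k))))
                    (half-shift (x + k))

  -- Below 2k the only words are the two constant ones.
  half-short : ∀ i → i ≤ K1 + k → half i ≡ 1
  half-short i i≤ = trans
    (cong₂ (λ f s → 1 + k * f + s) (F-short (i ∸ k) i∸k≤K1)
           (S-short (pred (i ∸ k)) (≤-trans pred[n]≤n i∸k≤K1)))
    (cong (λ z → 1 + z + 0) (*-zeroʳ k))
    where
      i∸k≤K1 : i ∸ k ≤ K1
      i∸k≤K1 = ≤-trans (∸-monoˡ-≤ k i≤) (≤-reflexive (m+n∸n≡m K1 k))

  half-rec : ∀ r → half (3 + r + 2 * k) + half (1 + r + 2 * k) ≡ 2 * half (2 + r + 2 * k) + half (3 + r)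
  half-rec r = begin
    half (3 + r + 2 * k) + half (1 + r + 2 * k)
      ≡⟨ cong₂ _+_ (half-2k (3 + r)) (half-2k (1 + r)) ⟩
    (1 + k * F (3 + r + k) + (S (1 + r + k) + F (2 + r + k))) + (1 + k * A + B)
      ≡⟨ cong₂ (λ f₂ f₃ → (1 + k * f₃ + ((B + A) + f₂)) + (1 + k * A + B)) F₂ F₃ ⟩
    (1 + k * ((A + (1 + Y)) + ((1 + Y) + X)) + ((B + A) + (A + (1 + Y)))) + (1 + k * A + B)
      ≡⟨ solve 5 (λ k A B X Y →
           (con 1 :+ k :* ((A :+ (con 1 :+ Y)) :+ ((con 1 :+ Y) :+ X)) :+ ((B :+ A) :+ (A :+ (con 1 :+ Y))))
             :+ (con 1 :+ k :* A :+ B)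
           := con 2 :* (con 1 :+ k :* (A :+ (con 1 :+ Y)) :+ (B :+ A)) :+ (con 1 :+ k :* X :+ Y))
           refl k A B X Y ⟩
    2 * (1 + k * (A + (1 + Y)) + (B + A)) + (1 + k * X + Y)
      ≡⟨ cong₂ (λ f₂ s → 2 * (1 + k * f₂ + (B + A)) + (1 + k * X + S s)) F₂ (pred[m∸n]≡m∸[1+n] (2 + r) K1) ⟨
    2 * (1 + k * F (2 + r + k) + S (1 + r + k)) + (1 + k * X + S (pred ((2 + r) ∸ K1)))
      ≡⟨ cong (λ h → 2 * h + half (3 + r)) (half-2k (2 + r)) ⟨
    2 * half (2 + r + 2 * k) + half (3 + r) ∎
    where
      open ≡-Reasoning
      A B X Y : ℕ
      A = F (1 + r + k)
      B = S (r + k)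
      X = F ((2 + r) ∸ K1)
      Y = S ((2 + r) ∸ k)
      T₂ : T (2 + r) ≡ 1 + Y
      T₂ = T-closed (2 + r)
      F₂ : F (2 + r + k) ≡ A + (1 + Y)
      F₂ = trans (F-after (1 + r)) (cong (A +_) T₂)
      F₃ : F (3 + r + k) ≡ (A + (1 + Y)) + ((1 + Y) + X)
      F₃ = trans (F-after (2 + r)) (cong₂ _+_ F₂ (trans (T-suc (2 + r)) (cong (_+ X) T₂)))

  -- F (t + k) = t + 1 while t ≤ k: up to then each step adds T = 1.
  F-early : ∀ t → t ≤ k → F (t + k) ≡ suc t
  F-early zero    _    = cong₂ _+_ (F-short K1 ≤-refl) (ways-hit-within true K1 K1 ≤-refl ≤-refl)
  F-early (suc t) t<k  = begin
    F (suc (t + k))        ≡⟨ F-after t ⟩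
    F (t + k) + T (suc t)  ≡⟨ cong₂ _+_ (F-early t (<⇒≤ t<k)) (T-early (suc t) t<k) ⟩
    suc t + 1              ≡⟨ +-comm (suc t) 1 ⟩
    suc (suc t)            ∎
    where open ≡-Reasoning

  half-early : 2 ≤ k → ∀ t → t ≤ 2 → half (t + 2 * k) + half (t + 2 * k) ≡ 2 + (t + 2 * k) * suc t
  half-early 2≤k t t≤2 = trans
    (cong (λ h → h + h) (trans (half-2k t) (cong (λ f → 1 + k * f + S (pred (t + k))) (F-early t (≤-trans t≤2 2≤k)))))
    (doubled t t≤2)
    where
      S₀ : S K1 ≡ 0
      S₀ = S-short K1 ≤-refl
      S₁ : S k ≡ 1
      S₁ = cong₂ _+_ S₀ (F-early 0 z≤n)
      S₂ : S (suc k) ≡ 3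
      S₂ = cong₂ _+_ S₁ (F-early 1 (≤-trans (s≤s z≤n) 2≤k))
      doubled : ∀ t → t ≤ 2 →
        (1 + k * suc t + S (pred (t + k))) + (1 + k * suc t + S (pred (t + k))) ≡ 2 + (t + 2 * k) * suc t
      doubled 0 _ = trans (cong (λ s → (1 + k * 1 + s) + (1 + k * 1 + s)) S₀)
        (solve 1 (λ k → (con 1 :+ k :* con 1 :+ con 0) :+ (con 1 :+ k :* con 1 :+ con 0)
                        := con 2 :+ (con 0 :+ con 2 :* k) :* con 1) refl k)
      doubled 1 _ = trans (cong (λ s → (1 + k * 2 + s) + (1 + k * 2 + s)) S₁)
        (solve 1 (λ k → (con 1 :+ k :* con 2 :+ con 1) :+ (con 1 :+ k :* con 2 :+ con 1)
                        := con 2 :+ (con 1 :+ con 2 :* k) :* con 2) refl k)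
      doubled 2 _ = trans (cong (λ s → (1 + k * 3 + s) + (1 + k * 3 + s)) S₂)
        (solve 1 (λ k → (con 1 :+ k :* con 3 :+ con 3) :+ (con 1 :+ k :* con 3 :+ con 3)
                        := con 2 :+ (con 2 :+ con 2 :* k) :* con 3) refl k)
      doubled (suc (suc (suc t))) (s≤s (s≤s ()))

  TwiceHalf : (ℕ → ℕ) → Set
  TwiceHalf A = ∀ n → 1 ≤ n → A n ≡ half n + half n

  twiceHalf-initial : ∀ {A} → TwiceHalf A → ∀ i → 3 ≤ i → i < 2 * k → A i ≡ 2
  twiceHalf-initial {A} twice i 3≤i i<2k =
    trans (twice i (≤-trans (s≤s z≤n) 3≤i)) (cong₂ _+_ (half-short i i≤) (half-short i i≤))
    where
      i≤ : i ≤ K1 + k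
      i≤ = ≤-pred (subst (i <_) (cong (λ z → suc (K1 + z)) (+-identityʳ k)) i<2k)

  twiceHalf-middle : ∀ {A} → TwiceHalf A → 2 ≤ k →
                     ∀ j → 2 * k ≤ j → j ≤ 2 * k + 2 → A j ≡ 2 + j * (j + 1 ∸ 2 * k)
  twiceHalf-middle {A} twice 2≤k j 2k≤j j≤ = subst (λ m → A m ≡ 2 + m * (m + 1 ∸ 2 * k)) j≡ (begin
    A (t + 2 * k)                               ≡⟨ twice (t + 2 * k) (≤-trans (s≤s z≤n) (m≤n+m (2 * k) t)) ⟩
    half (t + 2 * k) + half (t + 2 * k)         ≡⟨ half-early 2≤k t t≤2 ⟩
    2 + (t + 2 * k) * suc t                     ≡⟨ cong (λ z → 2 + (t + 2 * k) * z) offset ⟨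
    2 + (t + 2 * k) * (t + 2 * k + 1 ∸ 2 * k)   ∎)
    where
      open ≡-Reasoning
      t = j ∸ 2 * k
      j≡ : t + 2 * k ≡ j
      j≡ = m∸n+n≡m 2k≤j
      t≤2 : t ≤ 2
      t≤2 = +-cancelʳ-≤ (2 * k) t 2 (subst₂ _≤_ (sym j≡) (+-comm (2 * k) 2) j≤)
      offset : t + 2 * k + 1 ∸ 2 * k ≡ suc t
      offset = trans (cong (_∸ 2 * k) (+-comm (t + 2 * k) 1)) (m+n∸n≡m (suc t) (2 * k))

  twiceHalf-recurrence : ∀ {A} → TwiceHalf A →
                         ∀ n → 2 * k + 3 ≤ n → A n + A (n ∸ 2) ≡ 2 * A (n ∸ 1) + A (n ∸ 2 * k)
  twiceHalf-recurrence {A} twice n lo = subst (λ m → A m + A (m ∸ 2) ≡ 2 * A (m ∸ 1) + A (m ∸ 2 * k)) n≡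
    (subst (λ z → A (3 + r + 2 * k) + A (1 + r + 2 * k) ≡ 2 * A (2 + r + 2 * k) + A z)
           (sym (m+n∸n≡m (3 + r) (2 * k)))
           (begin
             A (3 + r + 2 * k) + A (1 + r + 2 * k)
               ≡⟨ cong₂ _+_ (twice (3 + r + 2 * k) (s≤s z≤n)) (twice (1 + r + 2 * k) (s≤s z≤n)) ⟩
             (half (3 + r + 2 * k) + half (3 + r + 2 * k)) + (half (1 + r + 2 * k) + half (1 + r + 2 * k))
               ≡⟨ doubled-rec (half (3 + r + 2 * k)) (half (1 + r + 2 * k)) (half (2 + r + 2 * k)) (half (3 + r))
                              (half-rec r) ⟩
             2 * (half (2 + r + 2 * k) + half (2 + r + 2 * k)) + (half (3 + r) + half (3 + r))
               ≡⟨ cong₂ (λ x y → 2 * x + y) (twice (2 + r + 2 * k) (s≤s z≤n)) (twice (3 + r) (s≤s z≤n)) ⟨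
             2 * A (2 + r + 2 * k) + A (3 + r) ∎))
    where
      open ≡-Reasoning
      r = n ∸ (2 * k + 3)
      n≡ : 3 + r + 2 * k ≡ n
      n≡ = trans (solve 2 (λ r m → con 3 :+ r :+ m := r :+ (m :+ con 3)) refl r (2 * k)) (m∸n+n≡m lo)

-- A state 'live c d' records the current bit c and the
-- deficit d of the current block; reading a bit different from c while d > 0 means a block
-- ended too early and the automaton dies.
module Deficit (K1 : ℕ) where
  open Paths K1 using (k)

  data State : Set where
    live : Bool → ℕ → State
    dead : State

  step : State → Bool → State
  step (live c zero)    y = if does (y ≟ᵇ c) then live c 0 else live y K1
  step (live c (suc d)) y = if does (y ≟ᵇ c) then live c d else dead
  step dead             y = dead

  run : State → (ℕ → Bool) → ℕ → ℕ → State
  run s f t zero    = s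
  run s f t (suc m) = run (step s (f t)) f (suc t) m

  step-same : ∀ c d y → y ≡ c → step (live c d) y ≡ live c (d ∸ 1)
  step-same c zero    y y≡c rewrite dec-true (y ≟ᵇ c) y≡c = refl
  step-same c (suc d) y y≡c rewrite dec-true (y ≟ᵇ c) y≡c = refl

  step-switch : ∀ c y → y ≢ c → step (live c 0) y ≡ live y K1
  step-switch c y y≢c rewrite dec-false (y ≟ᵇ c) y≢c = refl

  step-break : ∀ c d y → y ≢ c → 0 < d → step (live c d) y ≡ dead
  step-break c (suc d) y y≢c _ rewrite dec-false (y ≟ᵇ c) y≢c = refl

  run-dead : ∀ f t m → run dead f t m ≡ dead
  run-dead f t zero    = refl
  run-dead f t (suc m) = run-dead f (suc t) m

  run-break : ∀ s f t m → 0 < m → step s (f t) ≡ dead → run s f t m ≡ dead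
  run-break s f t (suc m) _ dies = trans (cong (λ u → run u f (suc t) m) dies) (run-dead f (suc t) m)

  run-split : ∀ s f t m m′ → run s f t (m + m′) ≡ run (run s f t m) f (t + m) m′
  run-split s f t zero    m′ = cong (λ u → run s f u m′) (sym (+-identityʳ t))
  run-split s f t (suc m) m′ =
    trans (run-split (step s (f t)) f (suc t) m m′)
          (cong (λ u → run (run (step s (f t)) f (suc t) m) f u m′) (sym (+-suc t m)))

  run-constant : ∀ f t m c d → (∀ j → j < m → f (t + j) ≡ c) → run (live c d) f t m ≡ live c (d ∸ m)
  run-constant f t zero    c d _     = refl
  run-constant f t (suc m) c d const = begin
    run (step (live c d) (f t)) f (suc t) m
      ≡⟨ cong (λ s → run s f (suc t) m) (step-same c d (f t) (trans (cong f (sym (+-identityʳ t))) (const 0 z<s))) ⟩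
    run (live c (d ∸ 1)) f (suc t) m
      ≡⟨ run-constant f (suc t) m c (d ∸ 1) (λ j j<m → trans (cong f (sym (+-suc t j))) (const (suc j) (s≤s j<m))) ⟩
    live c ((d ∸ 1) ∸ m)
      ≡⟨ cong (live c) (∸-+-assoc d 1 m) ⟩
    live c (d ∸ suc m) ∎
    where open ≡-Reasoning

  LongBefore : (ℕ → Bool) → ℕ → Set
  LongBefore f T = ∀ i j → j < k → suc i + j < T → f i ≢ f (suc i) → f (suc i + j) ≡ f (suc i)

  LongBefore-mono : ∀ f {T T′} → T′ ≤ T → LongBefore f T → LongBefore f T′
  LongBefore-mono f T′≤T long i j j<k lt bd = long i j j<k (<-≤-trans lt T′≤T) bd

  LongBefore-extend : ∀ f T → LongBefore f T →
    (∀ i j → j < k → suc i + j ≡ T → f i ≢ f (suc i) → f (suc i + j) ≡ f (suc i)) → LongBefore f (suc T)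
  LongBefore-extend f T long new i j j<k lt bd with m≤n⇒m<n∨m≡n (≤-pred lt)
  ... | inj₁ lt′ = long i j j<k lt′ bd
  ... | inj₂ eq  = new i j j<k eq bd

  -- The invariant of a live run that has read up to position t: c is the last bit;
  -- d < k; a positive d comes from the current block, started at i + 1 and read for w
  -- bits; every unfinished window of an earlier boundary is covered by the deficit.
  record Tracks (f : ℕ → Bool) (t : ℕ) (c : Bool) (d : ℕ) : Set where
    field
      colour  : c ≡ f t
      bounded : d < k
      owed    : d ≡ 0 ⊎ ∃₂ λ i w → suc i + w ≡ suc t × w + d ≡ k × f i ≢ f (suc i)
      covers  : ∀ i → suc i ≤ t → f i ≢ f (suc i) → suc t < suc i + k → suc i + k ≤ suc t + d

  deficit-shift : ∀ x d y → suc x < y → y ≤ x + d → y ≤ suc x + (d ∸ 1)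
  deficit-shift x zero    y x<y y≤x =
    ⊥-elim (<-irrefl refl (<-≤-trans (<-trans (n<1+n x) x<y) (≤-trans y≤x (≤-reflexive (+-identityʳ x)))))
  deficit-shift x (suc d) y _   y≤x = ≤-trans y≤x (≤-reflexive (+-suc x d))

  stay : ∀ {f t c d} → Tracks f t c d → LongBefore f (suc t) → f (suc t) ≡ c →
         LongBefore f (suc (suc t)) × Tracks f (suc t) c (d ∸ 1)
  stay {f} {t} {c} {d} tr long same = LongBefore-extend f (suc t) long continues , record
      { colour = sym same ; bounded = ≤-<-trans (m∸n≤m d 1) bounded
      ; owed = owed′ d owed ; covers = covers′ }
    where
      open Tracks tr
      continues : ∀ i j → j < k → suc i + j ≡ suc t → f i ≢ f (suc i) → f (suc i + j) ≡ f (suc i)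
      continues i zero    _   _  _  = cong f (+-identityʳ (suc i))
      continues i (suc j) j<k eq bd = begin
          f (suc i + suc j)  ≡⟨ cong f eq ⟩
          f (suc t)          ≡⟨ trans same colour ⟩
          f t                ≡⟨ cong f eq′ ⟨
          f (suc i + j)      ≡⟨ long i j (<-trans (n<1+n j) j<k) (s≤s (≤-reflexive eq′)) bd ⟩
          f (suc i)          ∎
        where
          open ≡-Reasoning
          eq′ : suc i + j ≡ t
          eq′ = suc-injective (trans (sym (+-suc (suc i) j)) eq)
      owed′ : ∀ d → d ≡ 0 ⊎ ∃₂ (λ i w → suc i + w ≡ suc t × w + d ≡ k × f i ≢ f (suc i)) →
              d ∸ 1 ≡ 0 ⊎ ∃₂ (λ i w → suc i + w ≡ suc (suc t) × w + (d ∸ 1) ≡ k × f i ≢ f (suc i))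
      owed′ zero    _       = inj₁ refl
      owed′ (suc d) (inj₁ ())
      owed′ (suc d) (inj₂ (i , w , pos , total , bd)) =
        inj₂ (i , suc w , trans (+-suc (suc i) w) (cong suc pos) , trans (sym (+-suc w d)) total , bd)
      covers′ : ∀ i → suc i ≤ suc t → f i ≢ f (suc i) → suc (suc t) < suc i + k → suc i + k ≤ suc (suc t) + (d ∸ 1)
      covers′ i le bd lt with m≤n⇒m<n∨m≡n le
      ... | inj₁ lt′ = deficit-shift (suc t) d (suc i + k) lt (covers i (≤-pred lt′) bd (<-trans (n<1+n (suc t)) lt))
      ... | inj₂ eq  = ⊥-elim (bd (trans (cong f (suc-injective eq))
                                   (trans (sym colour) (trans (sym same) (cong f (sym eq))))))

  switch : ∀ {f t c} → Tracks f t c 0 → LongBefore f (suc t) → f (suc t) ≢ c →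
           LongBefore f (suc (suc t)) × Tracks f (suc t) (f (suc t)) K1
  switch {f} {t} {c} tr long differ = LongBefore-extend f (suc t) long continues , record
      { colour = refl ; bounded = n<1+n K1
      ; owed = inj₂ (t , 1 , +-comm (suc t) 1 , refl , λ eq → differ (trans (sym eq) (sym colour)))
      ; covers = λ i le _ _ → ≤-trans (+-monoˡ-≤ k le) (≤-reflexive (+-suc (suc t) K1)) }
    where
      open Tracks tr
      continues : ∀ i j → j < k → suc i + j ≡ suc t → f i ≢ f (suc i) → f (suc i + j) ≡ f (suc i)
      continues i zero    _   _  _  = cong f (+-identityʳ (suc i))
      continues i (suc j) j<k eq bd =
        ⊥-elim (<-irrefl refl (<-≤-trans unfinished (≤-trans closed (≤-reflexive (+-identityʳ (suc t))))))
        where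
          unfinished : suc t < suc i + k
          unfinished = subst (_< suc i + k) eq (+-monoʳ-< (suc i) j<k)
          closed : suc i + k ≤ suc t + 0
          closed = covers i (≤-trans (m≤m+n (suc i) j) (≤-reflexive (suc-injective (trans (sym (+-suc (suc i) j)) eq))))
                          bd unfinished

  owed-forces : ∀ {f t c d} → Tracks f t c (suc d) → LongBefore f (suc (suc t)) → f (suc t) ≡ c
  owed-forces {f} {t} {c} {d} tr long with Tracks.owed tr
  ... | inj₂ (i , zero  , pos , total , bd) = ⊥-elim (<-irrefl total (Tracks.bounded tr))
  ... | inj₂ (i , suc w , pos , total , bd) = begin
      f (suc t)          ≡⟨ cong f pos ⟨
      f (suc i + suc w)  ≡⟨ long i (suc w) w<k (s≤s (≤-reflexive pos)) bd ⟩
      f (suc i)          ≡⟨ long i w (<-trans (n<1+n w) w<k) (s≤s (≤-trans (≤-reflexive pos′) (n≤1+n t))) bd ⟨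
      f (suc i + w)      ≡⟨ cong f pos′ ⟩
      f t                ≡⟨ Tracks.colour tr ⟨
      c                  ∎
    where
      open ≡-Reasoning
      w<k : suc w < k
      w<k = subst (suc w <_) total (m<m+n (suc w) z<s)
      pos′ : suc i + w ≡ t
      pos′ = suc-injective (trans (sym (+-suc (suc i) w)) pos)

  Tracked : (ℕ → Bool) → ℕ → State → Set
  Tracked f t (live c d) = Tracks f t c d
  Tracked f t dead       = ⊤

  live≢dead : ∀ {c d} → live c d ≢ dead
  live≢dead ()

  step-sound : ∀ {f t} s → Tracked f t s → LongBefore f (suc t) → step s (f (suc t)) ≢ dead →
               LongBefore f (suc (suc t)) × Tracked f (suc t) (step s (f (suc t)))
  step-sound {f} {t} (live c zero) tr long _ with f (suc t) ≟ᵇ c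
  ... | yes same   = stay tr long same
  ... | no  differ = switch tr long differ
  step-sound {f} {t} (live c (suc d)) tr long alive with f (suc t) ≟ᵇ c
  ... | yes same   = stay tr long same
  ... | no  _      = ⊥-elim (alive refl)
  step-sound dead _ _ alive = ⊥-elim (alive refl)

  step-complete : ∀ {f t} c d → Tracks f t c d → LongBefore f (suc (suc t)) → step (live c d) (f (suc t)) ≢ dead
  step-complete {f} {t} c zero tr long with f (suc t) ≟ᵇ c
  ... | yes _ = live≢dead
  ... | no  _ = live≢dead
  step-complete {f} {t} c (suc d) tr long =
    λ dies → live≢dead (trans (sym (step-same c (suc d) (f (suc t)) (owed-forces tr long))) dies)

  run-sound : ∀ {f} t m s → Tracked f t s → LongBefore f (suc t) → run s f (suc t) m ≢ dead →
              LongBefore f (suc t + m) × Tracked f (t + m) (run s f (suc t) m)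
  run-sound {f} t zero s tr long _ =
    subst (LongBefore f) (sym (+-identityʳ (suc t))) long , subst (λ u → Tracked f u s) (sym (+-identityʳ t)) tr
  run-sound {f} t (suc m) s tr long alive =
    subst (LongBefore f) (cong suc (sym (+-suc t m))) (proj₁ rest) ,
    subst (λ u → Tracked f u (run s f (suc t) (suc m))) (sym (+-suc t m)) (proj₂ rest)
    where
      s′ = step s (f (suc t))
      once = step-sound s tr long (λ dies → alive (trans (cong (λ u → run u f (suc (suc t)) m) dies) (run-dead f _ m)))
      rest = run-sound (suc t) m s′ (proj₂ once) (proj₁ once) alive

  run-complete : ∀ {f} t m s → Tracked f t s → s ≢ dead → LongBefore f (suc t + m) → run s f (suc t) m ≢ dead
  run-complete t zero    s          _  alive _    = alive
  run-complete t (suc m) dead       _  alive _    = ⊥-elim (alive refl)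
  run-complete {f} t (suc m) (live c d) tr _ long =
    run-complete (suc t) m (step (live c d) (f (suc t))) (proj₂ (step-sound (live c d) tr long₁ alive′)) alive′
      (subst (LongBefore f) (cong suc (+-suc t m)) long)
    where
      long₁ : LongBefore f (suc t)
      long₁ = LongBefore-mono f (s≤s (m≤m+n t (suc m))) long
      alive′ : step (live c d) (f (suc t)) ≢ dead
      alive′ = step-complete c d tr
        (LongBefore-mono f (s≤s (≤-trans (m≤m+n (suc t) m) (≤-reflexive (sym (+-suc t m))))) long)

-- In phase 'first x p' all p
-- bits so far were x; in phase 'later x p s' the first block had length p and the deficit
-- automaton is in state s.
module Phases (K1 : ℕ) where
  open Paths K1
  open Deficit K1

  data Phase : Set where
    first : Bool → ℕ → Phase
    later : Bool → ℕ → State → Phase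

  advance : Phase → Bool → Phase
  advance (first x p)   y = if does (y ≟ᵇ x) then first x (suc p) else later x p (live y K1)
  advance (later x p s) y = later x p (step s y)

  -- Acceptance of a word ending in a phase; a word that never left its first block
  -- is constant.
  accepted : Phase → Bool
  accepted (first x p)            = true
  accepted (later x p (live c d)) = closes p (does (c ≟ᵇ x)) d
  accepted (later x p dead)       = false

  feed : ∀ {m} → Phase → Vec Bool m → Phase
  feed φ []      = φ
  feed φ (y ∷ v) = feed (advance φ y) v

  feed-dead : ∀ {m} x p (v : Vec Bool m) → feed (later x p dead) v ≡ later x p dead
  feed-dead x p []      = refl
  feed-dead x p (y ∷ v) = feed-dead x p v

  count-dead : ∀ m x p → count m (λ v → accepted (feed (later x p dead) v)) ≡ 0
  count-dead m x p = trans (count-cong m (λ v → cong accepted (feed-dead x p v))) (count-false m)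

  not-same-false : ∀ x → not (does (false ≟ᵇ x)) ≡ does (true ≟ᵇ x)
  not-same-false false = refl
  not-same-false true  = refl

  not-same-true : ∀ x → not (does (true ≟ᵇ x)) ≡ does (false ≟ᵇ x)
  not-same-true false = refl
  not-same-true true  = refl

  count-later : ∀ m x p c d →
    count m (λ v → accepted (feed (later x p (live c d)) v)) ≡ ways (accepts p) (does (c ≟ᵇ x)) d m
  count-later zero    x p c     d       = refl
  count-later (suc m) x p false zero    = cong₂ _+_ (count-later m x p false 0)
    (trans (count-later m x p true K1) (cong (λ e → ways (accepts p) e K1 m) (sym (not-same-false x))))
  count-later (suc m) x p true  zero    = trans
    (cong₂ _+_ (count-later m x p false K1) (count-later m x p true 0))
    (trans (+-comm (ways (accepts p) (does (false ≟ᵇ x)) K1 m) (ways (accepts p) (does (true ≟ᵇ x)) 0 m))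
           (cong (λ e → ways (accepts p) (does (true ≟ᵇ x)) 0 m + ways (accepts p) e K1 m) (sym (not-same-true x))))
  count-later (suc m) x p false (suc d) = trans (cong₂ _+_ (count-later m x p false d) (count-dead m x p)) (+-identityʳ _)
  count-later (suc m) x p true  (suc d) = cong₂ _+_ (count-dead m x p) (count-later m x p true d)

  count-first : ∀ m x p → count m (λ v → accepted (feed (first x p) v)) ≡ firstRun p m
  count-first zero    x     p = refl
  count-first (suc m) false p = cong₂ _+_ (count-first m false (suc p)) (count-later m false p true K1)
  count-first (suc m) true  p = trans (cong₂ _+_ (count-later m true p false K1) (count-first m true (suc p)))
                                      (+-comm (afterFirst p m) (firstRun (suc p) m))

  start : ∀ {m} → Vec Bool (suc m) → Phase
  start (x ∷ v) = feed (first x 1) v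

  count-start : ∀ m → count (suc m) (λ v → accepted (start v)) ≡ firstRun 1 m + firstRun 1 m
  count-start m = cong₂ _+_ (count-first m false 1) (count-first m true 1)

module Cyclic (K1 : ℕ) where
  open Paths K1 using (k; closes)
  open Deficit K1
  open Phases K1

  feedFrom : Phase → (ℕ → Bool) → ℕ → ℕ → Phase
  feedFrom φ f t zero    = φ
  feedFrom φ f t (suc m) = feedFrom (advance φ (f t)) f (suc t) m

  deficitState : Phase → State
  deficitState (first x p)   = live x 0
  deficitState (later x p s) = s

  deficitState-advance : ∀ φ y → deficitState (advance φ y) ≡ step (deficitState φ) y
  deficitState-advance (first x p)   y with y ≟ᵇ x
  ... | yes _ = refl
  ... | no  _ = refl
  deficitState-advance (later x p s) y = refl

  deficitState-feed : ∀ φ f t m → deficitState (feedFrom φ f t m) ≡ run (deficitState φ) f t m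
  deficitState-feed φ f t zero    = refl
  deficitState-feed φ f t (suc m) =
    trans (deficitState-feed (advance φ (f t)) f (suc t) m) (cong (λ s → run s f (suc t) m) (deficitState-advance φ (f t)))

  Remembers : (ℕ → Bool) → ℕ → Phase → Set
  Remembers f t (first x p)   = 1 ≤ p × p ≡ t × (∀ j → j < t → f j ≡ x)
  Remembers f t (later x p s) = 1 ≤ p × p < t × (∀ j → j < p → f j ≡ x) × f p ≢ x

  remembers-advance : ∀ f t φ → Remembers f t φ → Remembers f (suc t) (advance φ (f t))
  remembers-advance f t (first x p) (p≥1 , refl , prefix) with f t ≟ᵇ x
  ... | yes same   = ≤-trans p≥1 (n≤1+n p) , refl , prefix′
    where
      prefix′ : ∀ j → j < suc t → f j ≡ x
      prefix′ j j<t with m≤n⇒m<n∨m≡n (≤-pred j<t)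
      ... | inj₁ j<p  = prefix j j<p
      ... | inj₂ refl = same
  ... | no  differ = p≥1 , n<1+n t , prefix , differ
  remembers-advance f t (later x p s) (p≥1 , p<t , prefix , ends) = p≥1 , m<n⇒m<1+n p<t , prefix , ends

  remembers-feed : ∀ f t φ m → Remembers f t φ → Remembers f (t + m) (feedFrom φ f t m)
  remembers-feed f t φ zero    sw = subst (λ u → Remembers f u φ) (sym (+-identityʳ t)) sw
  remembers-feed f t φ (suc m) sw = subst (λ u → Remembers f u (feedFrom φ f t (suc m))) (sym (+-suc t m))
    (remembers-feed f (suc t) (advance φ (f t)) m (remembers-advance f t φ sw))

  record StartsWith (f : ℕ → Bool) (x : Bool) (p : ℕ) : Set where
    field
      nonempty : 1 ≤ p
      prefix   : ∀ j → j < p → f j ≡ x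
      ends     : f p ≢ x

  split-k : ∀ {p} → p ≤ K1 → k ≡ p + suc (K1 ∸ p)
  split-k {p} p≤K1 = trans (cong suc (sym (m+[n∸m]≡n p≤K1))) (sym (+-suc p (K1 ∸ p)))

  through-boundary : ∀ {f x p} → StartsWith f x p → p ≤ K1 → ∀ {d} →
    run (live x d) f 0 k ≡ run (step (live x (d ∸ p)) (f p)) f (suc p) (K1 ∸ p)
  through-boundary {f} {x} {p} sw p≤K1 {d} = begin
    run (live x d) f 0 k                            ≡⟨ cong (run (live x d) f 0) (split-k p≤K1) ⟩
    run (live x d) f 0 (p + suc (K1 ∸ p))           ≡⟨ run-split (live x d) f 0 p (suc (K1 ∸ p)) ⟩
    run (run (live x d) f 0 p) f p (suc (K1 ∸ p))
      ≡⟨ cong (λ s → run s f p (suc (K1 ∸ p))) (run-constant f 0 p x d (StartsWith.prefix sw)) ⟩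
    run (live x (d ∸ p)) f p (suc (K1 ∸ p))         ∎
    where open ≡-Reasoning

  -- Closing the cycle when the last bit is x: the remaining deficit must fit into
  -- the first block (the block after it is long enough to cover the rest).
  closing-same : ∀ {f x p d} → StartsWith f x p → d < k → (∀ j → p + j < k → f (p + j) ≡ f p) →
                 (closes p true d ≡ true) ⇔ (run (live x d) f 0 k ≢ dead)
  closing-same {f} {x} {p} {d} sw d<k next with k ≤? p
  ... | yes k≤p = ⇔-both
          (dec-true (d ≤? p) (≤-trans (<⇒≤ d<k) k≤p))
          (subst (_≢ dead) (sym (run-constant f 0 k x d (λ j j<k → prefix j (<-≤-trans j<k k≤p)))) live≢dead)
    where open StartsWith sw
  ... | no  k≰p with d ≤? p
  ...   | yes d≤p = ⇔-both (dec-true (d ≤? p) d≤p) alive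
    where
      open StartsWith sw
      p≤K1 : p ≤ K1
      p≤K1 = ≤-pred (≰⇒> k≰p)
      second : ∀ j → j < K1 ∸ p → f (suc p + j) ≡ f p
      second j j<q = trans (cong f (sym (+-suc p j)))
        (next (suc j) (subst (p + suc j <_) (sym (split-k p≤K1)) (+-monoʳ-< p (s≤s j<q))))
      alive : run (live x d) f 0 k ≢ dead
      alive = subst (_≢ dead) (sym (begin
        run (live x d) f 0 k                             ≡⟨ through-boundary sw p≤K1 ⟩
        run (step (live x (d ∸ p)) (f p)) f (suc p) (K1 ∸ p)
          ≡⟨ cong (λ e → run (step (live x e) (f p)) f (suc p) (K1 ∸ p)) (m≤n⇒m∸n≡0 d≤p) ⟩
        run (step (live x 0) (f p)) f (suc p) (K1 ∸ p)
          ≡⟨ cong (λ s → run s f (suc p) (K1 ∸ p)) (step-switch x (f p) ends) ⟩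
        run (live (f p) K1) f (suc p) (K1 ∸ p)           ≡⟨ run-constant f (suc p) (K1 ∸ p) (f p) K1 second ⟩
        live (f p) (K1 ∸ (K1 ∸ p))                       ∎)) live≢dead
        where open ≡-Reasoning
  ...   | no  d≰p = ⇔-neither (dec-false (d ≤? p) d≰p) (λ alive → alive dies)
    where
      open StartsWith sw
      dies : run (live x d) f 0 k ≡ dead
      dies = trans (through-boundary sw (≤-pred (≰⇒> k≰p)))
        (run-break (live x (d ∸ p)) f p (suc (K1 ∸ p)) z<s
                   (step-break x (d ∸ p) (f p) ends (m<n⇒0<n∸m (≰⇒> d≰p))))

  switch-at-start : ∀ {f x p c} → StartsWith f x p → c ≢ x → run (live c 0) f 0 k ≡ run (live x K1) f 1 K1
  switch-at-start {f} {x} {p} {c} sw c≢x =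
    cong (λ s → run s f 1 K1) (trans (step-switch c (f 0) f0≢c) (cong (λ y → live y K1) f0≡x))
    where
      f0≡x : f 0 ≡ x
      f0≡x = StartsWith.prefix sw 0 (StartsWith.nonempty sw)
      f0≢c : f 0 ≢ c
      f0≢c e = c≢x (trans (sym e) f0≡x)

  short-first-block : ∀ {f x p} → StartsWith f x p → p ≤ K1 → run (live x K1) f 1 K1 ≡ dead
  short-first-block {f} {x} {suc p′} sw p≤K1 = begin
    run (live x K1) f 1 K1                          ≡⟨ cong (run (live x K1) f 1) (m+[n∸m]≡n p′≤K1) ⟨
    run (live x K1) f 1 (p′ + (K1 ∸ p′))            ≡⟨ run-split (live x K1) f 1 p′ (K1 ∸ p′) ⟩
    run (run (live x K1) f 1 p′) f (suc p′) (K1 ∸ p′)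
      ≡⟨ cong (λ s → run s f (suc p′) (K1 ∸ p′)) (run-constant f 1 p′ x K1 (λ j j<p′ → prefix (suc j) (s≤s j<p′))) ⟩
    run (live x (K1 ∸ p′)) f (suc p′) (K1 ∸ p′)
      ≡⟨ run-break (live x (K1 ∸ p′)) f (suc p′) (K1 ∸ p′) owing (step-break x (K1 ∸ p′) (f (suc p′)) ends owing) ⟩
    dead                                            ∎
    where
      open ≡-Reasoning
      open StartsWith sw
      p′≤K1 : p′ ≤ K1
      p′≤K1 = <⇒≤ p≤K1
      owing : 0 < K1 ∸ p′
      owing = m<n⇒0<n∸m p≤K1

  closing-other : ∀ {f x p c d} → StartsWith f x p → c ≢ x →
                  (closes p false d ≡ true) ⇔ (run (live c d) f 0 k ≢ dead)
  closing-other {f} {x} {p} {c} {zero} sw c≢x with k ≤? p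
  ... | yes k≤p = ⇔-both (dec-true (k ≤? p) k≤p)
          (subst (_≢ dead) (sym (trans (switch-at-start sw c≢x)
            (run-constant f 1 K1 x K1 (λ j j<K1 → StartsWith.prefix sw (suc j) (<-≤-trans (s≤s j<K1) k≤p))))) live≢dead)
  ... | no  k≰p = ⇔-neither (dec-false (k ≤? p) k≰p)
          (λ alive → alive (trans (switch-at-start sw c≢x) (short-first-block sw (≤-pred (≰⇒> k≰p)))))
  closing-other {f} {x} {p} {c} {suc d} sw c≢x = ⇔-neither refl
    (λ alive → alive (run-break (live c (suc d)) f 0 k z<s
                                (step-break c (suc d) (f 0) (λ e → c≢x (trans (sym e) f0≡x)) z<s)))
    where
      f0≡x : f 0 ≡ x
      f0≡x = StartsWith.prefix sw 0 (StartsWith.nonempty sw)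

  -- Every block of the cyclic word f of length n′ + 1 has at least k bits: a boundary
  -- before position i is followed by k equal bits (read cyclically).
  CyclicLong : (ℕ → Bool) → ℕ → Set
  CyclicLong f n′ = ∀ i → i < suc n′ → f (i + n′) ≢ f i → ∀ j → j < k → f (i + j) ≡ f i

  module Periodic (f : ℕ → Bool) (n′ : ℕ) (periodic : ∀ x y → x % suc n′ ≡ y % suc n′ → f x ≡ f y) where

    n : ℕ
    n = suc n′

    wrap : ∀ j → f (n + j) ≡ f j
    wrap j = periodic (n + j) j (trans (cong (_% n) (+-comm n j)) ([m+n]%n≡m%n j n))

    run-wrap : ∀ s t m → run s f (n + t) m ≡ run s f t m
    run-wrap s t zero    = refl
    run-wrap s t (suc m) = begin
      run (step s (f (n + t))) f (suc (n + t)) m  ≡⟨ cong (λ y → run (step s y) f (suc (n + t)) m) (wrap t) ⟩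
      run (step s (f t)) f (suc (n + t)) m        ≡⟨ cong (λ u → run (step s (f t)) f u m) (+-suc n t) ⟨
      run (step s (f t)) f (n + suc t) m          ≡⟨ run-wrap (step s (f t)) (suc t) m ⟩
      run (step s (f t)) f (suc t) m              ∎
      where open ≡-Reasoning

    mod-+ : ∀ u v → (u % n + v) % n ≡ (u + v) % n
    mod-+ u v = trans (%-distribˡ-+ (u % n) v n)
      (trans (cong (λ z → (z + v % n) % n) (m%n%n≡m%n u n)) (sym (%-distribˡ-+ u v n)))

    cyclic⇒linear : CyclicLong f n′ → ∀ T → LongBefore f T
    cyclic⇒linear cl T i j j<k _ bd =
      trans (sym (periodic (r + j) (suc i + j) (mod-+ (suc i) j))) (trans (cl r (m%n<n (suc i) n) bd′ j j<k) fr)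
      where
        r = suc i % n
        fr : f r ≡ f (suc i)
        fr = periodic r (suc i) (m%n%n≡m%n (suc i) n)
        fi : f (r + n′) ≡ f i
        fi = periodic (r + n′) i (trans (mod-+ (suc i) n′) (trans (cong (_% n) (sym (+-suc i n′))) ([m+n]%n≡m%n i n)))
        bd′ : f (r + n′) ≢ f r
        bd′ e = bd (trans (sym fi) (trans e fr))

    linear⇒cyclic : LongBefore f (n + k) → CyclicLong f n′
    linear⇒cyclic long zero    _   bd j j<k = trans (sym (wrap j)) (trans continues (periodic n 0 (n%n≡0 n)))
      where
        continues : f (n + j) ≡ f n
        continues = long n′ j j<k (+-monoʳ-< n j<k) (λ e → bd (trans e (periodic n 0 (n%n≡0 n))))
    linear⇒cyclic long (suc i) i<n bd j j<k = long i j j<k (+-mono-< i<n j<k) (λ e → bd (trans (sym fi) e))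
      where
        fi : f i ≡ f (suc i + n′)
        fi = periodic i (suc i + n′) (sym (trans (cong (_% n) (sym (+-suc i n′))) ([m+n]%n≡m%n i n)))

    block-after-first : ∀ {x p} → LongBefore f n → StartsWith f x p → ∀ j → j < k → p + j < n → f (p + j) ≡ f p
    block-after-first {x} {suc p′} long sw j j<k p+j<n =
      long p′ j j<k p+j<n (λ e → StartsWith.ends sw (trans (sym e) (StartsWith.prefix sw p′ (n<1+n p′))))

    second-block : ∀ {x p} → LongBefore f n → StartsWith f x p → p < n → f n′ ≡ x →
                   ∀ j → p + j < k → f (p + j) ≡ f p
    second-block {x} {p} long sw p<n last j p+j<k with n ≤? p + j
    ... | no  n≰p+j = block-after-first long sw j (≤-<-trans (m≤n+m j p) p+j<k) (≰⇒> n≰p+j)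
    ... | yes n≤p+j = ⊥-elim (StartsWith.ends sw (trans (sym reaches) last))
      where
        p≤n′ : p ≤ n′
        p≤n′ = ≤-pred p<n
        reaches : f n′ ≡ f p
        reaches = trans (cong f (sym (m+[n∸m]≡n p≤n′)))
          (block-after-first long sw (n′ ∸ p)
            (<-≤-trans (+-cancelˡ-< p (n′ ∸ p) j (subst (_< p + j) (sym (m+[n∸m]≡n p≤n′)) n≤p+j))
                       (≤-trans (m≤n+m j p) (<⇒≤ p+j<k)))
            (subst (_< n) (sym (m+[n∸m]≡n p≤n′)) (n<1+n n′)))

    tracks-start : Tracks f 0 (f 0) 0
    tracks-start = record { colour = refl ; bounded = z<s ; owed = inj₁ refl ; covers = λ i () }

    long-1 : LongBefore f 1
    long-1 i j _ (s≤s ()) _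

    -- The cycle is closed by k more bits, which are the first k bits again.
    tail-equivalence : ∀ {c d} → LongBefore f n → Tracks f n′ c d →
                       (run (live c d) f 0 k ≢ dead) ⇔ CyclicLong f n′
    tail-equivalence {c} {d} long tr = mk⇔
      (λ alive → linear⇒cyclic (proj₁ (run-sound n′ k (live c d) tr long (subst (_≢ dead) (sym wrapped) alive))))
      (λ cl → subst (_≢ dead) wrapped (run-complete n′ k (live c d) tr live≢dead (cyclic⇒linear cl (n + k))))
      where
        wrapped : run (live c d) f n k ≡ run (live c d) f 0 k
        wrapped = trans (cong (λ u → run (live c d) f u k) (sym (+-identityʳ n))) (run-wrap (live c d) 0 k)

    accept-by-phase : ∀ φ → Remembers f n φ → deficitState φ ≡ run (live (f 0) 0) f 1 n′ →
                      (accepted φ ≡ true) ⇔ CyclicLong f n′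
    accept-by-phase (first x p) (_ , _ , constant) _ = ⇔-both refl no-boundary
      where
        no-boundary : CyclicLong f n′
        no-boundary i i<n bd = ⊥-elim (bd (begin
          f (i + n′)        ≡⟨ periodic (i + n′) ((i + n′) % n) (sym (m%n%n≡m%n (i + n′) n)) ⟩
          f ((i + n′) % n)  ≡⟨ constant _ (m%n<n (i + n′) n) ⟩
          x                 ≡⟨ constant i i<n ⟨
          f i               ∎))
          where open ≡-Reasoning
    accept-by-phase (later x p dead) _ dies = ⇔-neither refl
      (λ cl → run-complete 0 n′ (live (f 0) 0) tracks-start live≢dead (cyclic⇒linear cl n) (sym dies))
    accept-by-phase (later x p (live c d)) (p≥1 , p<n , prefix , ends) reached =
      ⇔-trans closing (tail-equivalence long tr)
      where
        sound = run-sound 0 n′ (live (f 0) 0) tracks-start long-1 (subst (_≢ dead) reached live≢dead)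
        long : LongBefore f n
        long = proj₁ sound
        tr : Tracks f n′ c d
        tr = subst (Tracked f n′) (sym reached) (proj₂ sound)
        starts : StartsWith f x p
        starts = record { nonempty = p≥1 ; prefix = prefix ; ends = ends }
        closing : (closes p (does (c ≟ᵇ x)) d ≡ true) ⇔ (run (live c d) f 0 k ≢ dead)
        closing with c ≟ᵇ x
        ... | yes refl = closing-same starts (Tracks.bounded tr) (second-block long starts p<n (sym (Tracks.colour tr)))
        ... | no  c≢x  = closing-other {d = d} starts c≢x

    accept : (accepted (feedFrom (first (f 0) 1) f 1 n′) ≡ true) ⇔ CyclicLong f n′
    accept = accept-by-phase (feedFrom (first (f 0) 1) f 1 n′)
      (remembers-feed f 1 (first (f 0) 1) n′ (≤-refl , refl , λ { zero _ → refl ; (suc j) (s≤s ()) }))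
      (deficitState-feed (first (f 0) 1) f 1 n′)

module Blocks (K1 : ℕ) where
  open Paths K1 using (k; half; firstRun; firstRun-half)
  open Phases K1 using (first; feed; start; accepted; advance; count-start)
  open Cyclic K1 using (CyclicLong; module Periodic; feedFrom)

  at-periodic : ∀ {n′} (b : Vec Bool (suc n′)) x y → x % suc n′ ≡ y % suc n′ → at b x ≡ at b y
  at-periodic {n′} b x y eq =
    cong (lookup b) (fromℕ<-cong (x % suc n′) (y % suc n′) eq (m%n<n x (suc n′)) (m%n<n y (suc n′)))

  block-at : ∀ {n′} (b : Vec Bool (suc n′)) i → i < suc n′ → at b (i + n′) ≢ at b i →
             ∃ λ L → L < suc n′ × IsBlock b i L
  block-at {n′} b i i<n starts with first-change (λ j → at b (i + j)) (at b i) (suc n′)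
  ... | inj₁ before = ⊥-elim (starts (before n′ (n<1+n n′)))
  ... | inj₂ (zero  , _   , changed , _)      = ⊥-elim (changed (cong (at b) (+-identityʳ i)))
  ... | inj₂ (suc L , L<n , changed , before) =
    suc L , L<n , s≤s z≤n , <⇒≤ L<n , (λ j → before (toℕ j) (toℕ<n j)) , inj₂ (starts , changed)

  fin-block : ∀ {n′} {b : Vec Bool (suc n′)} {i L} (i<n : i < suc n′) (L<n : L < suc n′) →
              IsBlock b i L → IsBlock b (toℕ (fromℕ< i<n)) (toℕ (fromℕ< (m<n⇒m<1+n L<n)))
  fin-block {b = b} i<n L<n = subst₂ (IsBlock b) (sym (toℕ-fromℕ< i<n)) (sym (toℕ-fromℕ< (m<n⇒m<1+n L<n)))

  InB⇒CyclicLong : ∀ n′ (b : Vec Bool (suc n′)) → InB k (suc n′) b → CyclicLong (at b) n′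
  InB⇒CyclicLong n′ b (long , whole) i i<n starts j j<k with block-at b i i<n starts
  ... | L , L<n , block with k ≤? suc n′
  ...   | yes k≤n = subst (λ m → at b (i + m) ≡ at b i) (toℕ-fromℕ< j<L) (proj₁ (proj₂ (proj₂ block)) (fromℕ< j<L))
    where
      k≤L : k ≤ L
      k≤L = subst (k ≤_) (toℕ-fromℕ< (m<n⇒m<1+n L<n))
                  (long k≤n (fromℕ< i<n) (fromℕ< (m<n⇒m<1+n L<n)) (fin-block {b = b} i<n L<n block))
      j<L : j < L
      j<L = <-≤-trans j<k k≤L
  ...   | no  k≰n = ⊥-elim (<-irrefl L≡n L<n)
    where
      L≡n : L ≡ suc n′
      L≡n = trans (sym (toℕ-fromℕ< (m<n⇒m<1+n L<n)))
                  (whole (≰⇒> k≰n) (fromℕ< i<n) (fromℕ< (m<n⇒m<1+n L<n)) (fin-block {b = b} i<n L<n block))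

  CyclicLong⇒InB : ∀ n′ (b : Vec Bool (suc n′)) → CyclicLong (at b) n′ → InB k (suc n′) b
  CyclicLong⇒InB n′ b cl = long , whole
    where
      long : k ≤ suc n′ → (i : Fin (suc n′)) (L : Fin (suc (suc n′))) → IsBlock b (toℕ i) (toℕ L) → k ≤ toℕ L
      long k≤n i L (_ , _ , _ , inj₁ L≡n) = subst (k ≤_) (sym L≡n) k≤n
      long k≤n i L (_ , _ , _ , inj₂ (starts , ends)) with k ≤? toℕ L
      ... | yes k≤L = k≤L
      ... | no  k≰L = ⊥-elim (ends (cl (toℕ i) (toℕ<n i) starts (toℕ L) (≰⇒> k≰L)))
      whole : suc n′ < k → (i : Fin (suc n′)) (L : Fin (suc (suc n′))) → IsBlock b (toℕ i) (toℕ L) → toℕ L ≡ suc n′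
      whole n<k i L (_ , _ , _ , inj₁ L≡n)        = L≡n
      whole n<k i L (_ , _ , _ , inj₂ (starts , _)) =
        ⊥-elim (starts (cl (toℕ i) (toℕ<n i) starts n′ (<-trans (n<1+n n′) n<k)))

  feed-feedFrom : ∀ {m} φ (v : Vec Bool m) g t → (∀ j (j<m : j < m) → g (t + j) ≡ lookup v (fromℕ< j<m)) →
                  feed φ v ≡ feedFrom φ g t m
  feed-feedFrom φ []      g t _     = refl
  feed-feedFrom φ (y ∷ v) g t reads = trans (cong (λ z → feed (advance φ z) v) (sym g-t))
    (feed-feedFrom (advance φ (g t)) v g (suc t) (λ j j<m → trans (cong g (sym (+-suc t j))) (reads (suc j) (s≤s j<m))))
    where
      g-t : g t ≡ y
      g-t = trans (cong g (sym (+-identityʳ t))) (reads 0 z<s)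

  start-feedFrom : ∀ {n′} (b : Vec Bool (suc n′)) → start b ≡ feedFrom (first (at b 0) 1) (at b) 1 n′
  start-feedFrom {n′} (x ∷ v) = feed-feedFrom (first x 1) v (at (x ∷ v)) 1 reads
    where
      reads : ∀ j (j<n : j < n′) → at (x ∷ v) (1 + j) ≡ lookup v (fromℕ< j<n)
      reads j j<n = cong (lookup (x ∷ v))
        (fromℕ<-cong (suc j % suc n′) (suc j) (m<n⇒m%n≡m (s≤s j<n)) (m%n<n (suc j) (suc n′)) (s≤s j<n))

  does-inB : ∀ n′ (b : Vec Bool (suc n′)) → does (inB? k (suc n′) b) ≡ accepted (start b)
  does-inB n′ b = does-by (inB? k (suc n′) b)
    (⇔-trans (subst (λ φ → (accepted φ ≡ true) ⇔ CyclicLong (at b) n′) (sym (start-feedFrom b))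
                      (Periodic.accept (at b) n′ (at-periodic b)))
               (mk⇔ (CyclicLong⇒InB n′ b) (InB⇒CyclicLong n′ b)))

  a-half : ∀ n′ → a k (suc n′) ≡ half (suc n′) + half (suc n′)
  a-half n′ = begin
    a k (suc n′)                                                ≡⟨ count-allStrings (suc n′) (inB? k (suc n′)) ⟩
    count (suc n′) (λ b → does (inB? k (suc n′) b))             ≡⟨ count-cong (suc n′) (does-inB n′) ⟩
    count (suc n′) (λ b → accepted (start b))                   ≡⟨ count-start n′ ⟩
    firstRun 1 n′ + firstRun 1 n′                               ≡⟨ cong₂ _+_ (firstRun-half n′) (firstRun-half n′) ⟩
    half (suc n′) + half (suc n′)                               ∎
    where open ≡-Reasoning

mainTheorem1 : (k : ℕ) → 2 ≤ k →
    ((i : ℕ) → 3 ≤ i → i < 2 * k → a k i ≡ 2) ×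
    ((j : ℕ) → 2 * k ≤ j → j ≤ 2 * k + 2 → a k j ≡ 2 + j * (j + 1 ∸ 2 * k)) ×
    ((n : ℕ) → 2 * k + 3 ≤ n → a k n + a k (n ∸ 2) ≡ 2 * a k (n ∸ 1) + a k (n ∸ 2 * k))
mainTheorem1 (suc K1) 2≤k =
  twiceHalf-initial a-twiceHalf , twiceHalf-middle a-twiceHalf 2≤k , twiceHalf-recurrence a-twiceHalf
  where
    open Paths K1
    a-twiceHalf : TwiceHalf (a k)
    a-twiceHalf (suc n′) _ = Blocks.a-half K1 n′
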